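{- Let $m,n\ge 3$ be integers and let $T^f[m,n]$ be the triangular lattice network with free boundary condition (defined in the context). Then for all real numbers $a,b$, \begin{align*} Z_{a,b}(T^f[m,n])={}&4(2^{a+2b}+2^{2a+b})+2[3(mn+7)-8(m+n)]\cdot 6^{a+b}+2(3^a6^b+3^b6^a)\\ &+(m+n-5)\,2^{2(a+b+1)}+4(m+n-5)(4^a6^b+4^b6^a)+4(3^a4^b+3^b4^a). \end{align*}
   Context: For a simple graph $G$ with vertex degrees $d(v)$ and real numbers $a,b$, the general Zagreb index is $Z_{a,b}(G)=\sum_{uv\in E(G)}\big(d(u)^a d(v)^b+d(u)^b d(v)^a\big)$. The triangular lattice network with free boundary condition $T^f[m,n]$ is the graph with vertex set $\{(i,j):1\le i\le m,\ 1\le j\le n\}$ and edges $(i,j)(i,j+1)$ for $1\le i\le m$, $1\le j\le n-1$; $(i,j)(i+1,j)$ for $1\le i\le m-1$, $1\le j\le n$; and $(i,j)(i+1,j+1)$ for $1\le i\le m-1$, $1\le j\le n-1$ (i.e. the grid $P_m\square P_n$ with one diagonal, always in the same direction, added to each unit square). -}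

module Defs where

open import Level using (Level)
open import Data.Nat using (ℕ; zero; suc; _∸_)
open import Data.Nat.Properties using () renaming (_≟_ to _≟ℕ_)
open import Data.Product using (_×_; _,_; proj₁; proj₂)
open import Data.Product.Properties using (≡-dec)
open import Data.List using (List; []; _∷_; map; concatMap; upTo; length; filter; _++_)
open import Relation.Nullary.Decidable using (_⊎-dec_)
open import Algebra.Bundles using (CommutativeRing)

-- Vertices of T^f[m,n] are pairs (i , j) with 1 ≤ i ≤ m, 1 ≤ j ≤ n.
Vertex : Set
Vertex = ℕ × ℕ

Edge : Set
Edge = Vertex × Vertex

range1 : ℕ → List ℕ
range1 k = map suc (upTo k)

triEdges : ℕ → ℕ → List Edge
triEdges m n =
     concatMap (λ i → map (λ j → ((i , j) , (i , suc j))) (range1 (n ∸ 1))) (range1 m)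
  ++ concatMap (λ i → map (λ j → ((i , j) , (suc i , j))) (range1 n)) (range1 (m ∸ 1))
  ++ concatMap (λ i → map (λ j → ((i , j) , (suc i , suc j))) (range1 (n ∸ 1))) (range1 (m ∸ 1))

_≟V_ = ≡-dec _≟ℕ_ _≟ℕ_

degree : ℕ → ℕ → Vertex → ℕ
degree m n v = length (filter (λ e → (proj₁ e ≟V v) ⊎-dec (proj₂ e ≟V v)) (triEdges m n))

module _ {c ℓ : Level} (R : CommutativeRing c ℓ) where
  open CommutativeRing R

  ι : ℕ → Carrier
  ι zero = 0#
  ι (suc k) = 1# + ι k

  sumR : List Carrier → Carrier
  sumR [] = 0#
  sumR (x ∷ xs) = x + sumR xs

  -- Abstract real exponentiation d ^ x for positive integer bases d and
  -- exponents x in the ring (for R = ℝ, pow d x = d ^ x is an instance).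
  record IsPow (pow : ℕ → Carrier → Carrier) : Set (c Level.⊔ ℓ) where
    field
      pow-+  : ∀ d x y → pow (suc d) (x + y) ≈ pow (suc d) x * pow (suc d) y
      pow-1  : ∀ d → pow (suc d) 1# ≈ ι (suc d)
      pow-*  : ∀ c d x → pow (suc c Data.Nat.* suc d) x ≈ pow (suc c) x * pow (suc d) x
      pow-cong : ∀ d {x y} → x ≈ y → pow d x ≈ pow d y

  zagreb : (pow : ℕ → Carrier → Carrier) → ℕ → ℕ → Carrier → Carrier → Carrier
  zagreb pow m n a b = sumR (map term (triEdges m n))
    where
    term : Edge → Carrier
    term (u , v) = pow (degree m n u) a * pow (degree m n v) b
                 + pow (degree m n v) a * pow (degree m n u) b

-- Each coordinate of a vertex (i , j) of T^f[m,n] is first, inner or last on its line, and the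
-- degree of (i , j) depends only on these two places: 2 or 3 at the corners, 4 on the rest of the
-- boundary, 6 inside.  Split the edges into horizontal, vertical and diagonal ones.  The Zagreb
-- sum over each kind is a double sum over rows and columns whose terms depend only on places, so
-- every line contributes (first term) + (multiplicity) · (inner term) + (last term).  Since
-- 4^x = 2^x 2^x and 6^x = 2^x 3^x, what remains is a polynomial identity in m − 3, n − 3, 2^a,
-- 3^a, 2^b and 3^b, which the ring solver checks.

module Submission where

open import Defs
open import Level using (Level)
open import Data.Nat using (ℕ; zero; suc; _≤_; s≤s)
open import Algebra.Bundles using (CommutativeRing)

module Degrees where

  open import Algebra.Bundles using (CommutativeMonoid)
  open import Data.Bool using (Bool; true; false; _∧_; _∨_)
  open import Data.Bool.Properties using (∧-zeroʳ; ∧-commutativeMonoid)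
  open import Data.Nat using (_+_; _*_; _∸_; _<_; _≡ᵇ_; z≤n)
  open import Data.Nat.Properties
    using (_≟_; ≤-refl; ≤-trans; <⇒≤; +-assoc; +-suc; +-identityʳ; *-zeroʳ; m≤m+n; n<1+n;
           m<n⇒m<1+n; ≤∧≢⇒<; <⇒≢; >⇒≢; <⇒≱)
  open import Data.Nat.Tactic.RingSolver using (solve-∀)
  open import Data.Product using (_,_; proj₁; proj₂)
  open import Data.List using (List; []; _∷_; map; concatMap; upTo; applyUpTo; length; filter; _++_)
  open import Data.List.Properties using (map-upTo)
  open import Relation.Nullary using (does; yes; no; contradiction)
  open import Relation.Nullary.Decidable using (dec-true; dec-false; _⊎-dec_)
  open import Relation.Unary using (Pred; Decidable)
  open import Relation.Binary.PropositionalEquality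
    using (_≡_; refl; sym; trans; cong; cong₂; subst; module ≡-Reasoning)
  open import Algebra.Properties.CommutativeSemigroup
    (CommutativeMonoid.commutativeSemigroup ∧-commutativeMonoid) using (interchange)

  indicator : Bool → ℕ
  indicator true  = 1
  indicator false = 0

  count : {A : Set} → (A → Bool) → List A → ℕ
  count p []       = 0
  count p (x ∷ xs) = indicator (p x) + count p xs

  length-filter≡count : {A : Set} {ℓ : Level} {P : Pred A ℓ} (P? : Decidable P) (xs : List A) →
                        length (filter P? xs) ≡ count (λ x → does (P? x)) xs
  length-filter≡count P? []       = refl
  length-filter≡count P? (x ∷ xs) with does (P? x)
  ... | true  = cong suc (length-filter≡count P? xs)
  ... | false = length-filter≡count P? xs

  count-++ : {A : Set} (p : A → Bool) (xs ys : List A) → count p (xs ++ ys) ≡ count p xs + count p ys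
  count-++ p []       ys = refl
  count-++ p (x ∷ xs) ys =
    trans (cong (indicator (p x) +_) (count-++ p xs ys)) (sym (+-assoc (indicator (p x)) _ _))

  count-map : {A B : Set} (p : B → Bool) (f : A → B) (xs : List A) →
              count p (map f xs) ≡ count (λ x → p (f x)) xs
  count-map p f []       = refl
  count-map p f (x ∷ xs) = cong (indicator (p (f x)) +_) (count-map p f xs)

  indicator-∨ : ∀ a b → a ∧ b ≡ false → indicator (a ∨ b) ≡ indicator a + indicator b
  indicator-∨ true  true  ()
  indicator-∨ true  false _ = refl
  indicator-∨ false b     _ = refl

  indicator-∧ : ∀ a b → indicator (a ∧ b) ≡ indicator a * indicator b
  indicator-∧ true  b = sym (+-identityʳ (indicator b))
  indicator-∧ false b = refl

  ∧-disjointˡ : ∀ a b c d → a ∧ c ≡ false → (a ∧ b) ∧ (c ∧ d) ≡ false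
  ∧-disjointˡ a b c d ac = trans (interchange a b c d) (cong (_∧ (b ∧ d)) ac)

  ∧-disjointʳ : ∀ a b c d → b ∧ d ≡ false → (a ∧ b) ∧ (c ∧ d) ≡ false
  ∧-disjointʳ a b c d bd = trans (interchange a b c d) (trans (cong ((a ∧ c) ∧_) bd) (∧-zeroʳ (a ∧ c)))

  module _ {A X Y : Set} (p : A → Bool) (e : X → Y → A) (u u′ : X → Bool) (v v′ : Y → Bool)
           (p-e : ∀ x y → p (e x y) ≡ (u x ∧ v y) ∨ (u′ x ∧ v′ y))
           (disjoint : ∀ x y → (u x ∧ v y) ∧ (u′ x ∧ v′ y) ≡ false) where

    private
      indicator-p-e : ∀ x y → indicator (p (e x y))
                            ≡ indicator (u x) * indicator (v y) + indicator (u′ x) * indicator (v′ y)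
      indicator-p-e x y = begin
        indicator (p (e x y))                           ≡⟨ cong indicator (p-e x y) ⟩
        indicator ((u x ∧ v y) ∨ (u′ x ∧ v′ y))         ≡⟨ indicator-∨ (u x ∧ v y) (u′ x ∧ v′ y) (disjoint x y) ⟩
        indicator (u x ∧ v y) + indicator (u′ x ∧ v′ y) ≡⟨ cong₂ _+_ (indicator-∧ (u x) (v y))
                                                                     (indicator-∧ (u′ x) (v′ y)) ⟩
        indicator (u x) * indicator (v y) + indicator (u′ x) * indicator (v′ y) ∎
        where open ≡-Reasoning

      count-row : ∀ x ys → count p (map (e x) ys) ≡ indicator (u x) * count v ys + indicator (u′ x) * count v′ ys
      count-row x []       = sym (cong₂ _+_ (*-zeroʳ (indicator (u x))) (*-zeroʳ (indicator (u′ x))))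
      count-row x (y ∷ ys) =
        trans (cong₂ _+_ (indicator-p-e x y) (count-row x ys))
              (regroup (indicator (u x)) (indicator (v y)) (indicator (u′ x)) (indicator (v′ y))
                       (count v ys) (count v′ ys))
        where
        regroup : ∀ a b c d b′ d′ → (a * b + c * d) + (a * b′ + c * d′) ≡ a * (b + b′) + c * (d + d′)
        regroup = solve-∀

    count-grid : ∀ xs ys → count p (concatMap (λ x → map (e x) ys) xs)
                         ≡ count u xs * count v ys + count u′ xs * count v′ ys
    count-grid []       ys = refl
    count-grid (x ∷ xs) ys =
      trans (count-++ p (map (e x) ys) _)
            (trans (cong₂ _+_ (count-row x ys) (count-grid xs ys))
                   (regroup (indicator (u x)) (indicator (u′ x)) (count u xs) (count v ys)
                            (count u′ xs) (count v′ ys)))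
      where
      regroup : ∀ a c a′ b c′ d → (a * b + c * d) + (a′ * b + c′ * d) ≡ (a + a′) * b + (c + c′) * d
      regroup = solve-∀

  range : ℕ → ℕ → List ℕ
  range s zero    = []
  range s (suc k) = s ∷ range (suc s) k

  map-suc-range : ∀ s k → map suc (range s k) ≡ range (suc s) k
  map-suc-range s zero    = refl
  map-suc-range s (suc k) = cong (suc s ∷_) (map-suc-range (suc s) k)

  upTo≡range : ∀ k → upTo k ≡ range 0 k
  upTo≡range zero    = refl
  upTo≡range (suc k) = cong (0 ∷_) (begin
    applyUpTo suc k     ≡⟨ sym (map-upTo suc k) ⟩
    map suc (upTo k)    ≡⟨ cong (map suc) (upTo≡range k) ⟩
    map suc (range 0 k) ≡⟨ map-suc-range 0 k ⟩
    range 1 k           ∎)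
    where open ≡-Reasoning

  range1≡range : ∀ k → range1 k ≡ range 1 k
  range1≡range k = trans (cong (map suc) (upTo≡range k)) (map-suc-range 0 k)

  count-range-below : ∀ s k {c} → c < s → count (_≡ᵇ c) (range s k) ≡ 0
  count-range-below s zero        c<s = refl
  count-range-below s (suc k) {c} c<s =
    cong₂ _+_ (cong indicator (dec-false (s ≟ c) (>⇒≢ c<s))) (count-range-below (suc s) k (m<n⇒m<1+n c<s))

  count-range-above : ∀ s k {c} → s + k ≤ c → count (_≡ᵇ c) (range s k) ≡ 0
  count-range-above s zero        s+k≤c = refl
  count-range-above s (suc k) {c} s+k≤c =
    cong₂ _+_ (cong indicator (dec-false (s ≟ c) (<⇒≢ (≤-trans (s≤s (m≤m+n s k)) s+1+k≤c))))
              (count-range-above (suc s) k s+1+k≤c)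
    where
    s+1+k≤c : suc s + k ≤ c
    s+1+k≤c = subst (_≤ c) (+-suc s k) s+k≤c

  count-range-inside : ∀ s k {c} → s ≤ c → c < s + k → count (_≡ᵇ c) (range s k) ≡ 1
  count-range-inside s zero    {c} s≤c c<s+0   =
    contradiction s≤c (<⇒≱ (subst (c <_) (+-identityʳ s) c<s+0))
  count-range-inside s (suc k) {c} s≤c c<s+1+k with s ≟ c
  ... | yes refl = cong₂ _+_ (cong indicator (dec-true (s ≟ s) refl)) (count-range-below (suc s) k (n<1+n s))
  ... | no  s≢c  = cong₂ _+_ (cong indicator (dec-false (s ≟ c) s≢c))
                             (count-range-inside (suc s) k (≤∧≢⇒< s≤c s≢c) (subst (c <_) (+-suc s k) c<s+1+k))

  data Place : Set where
    first inner last : Place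

  data PlaceOf : ℕ → ℕ → Place → Set where
    at-first : ∀ {k}   → PlaceOf (2 + k) 1 first
    at-inner : ∀ {k i} → 1 < i → i < 2 + k → PlaceOf (2 + k) i inner
    at-last  : ∀ {k}   → PlaceOf (2 + k) (2 + k) last

  placeOf⇒1≤ : ∀ {m i c} → PlaceOf m i c → 1 ≤ i
  placeOf⇒1≤ at-first         = ≤-refl
  placeOf⇒1≤ (at-inner 1<i _) = <⇒≤ 1<i
  placeOf⇒1≤ at-last          = s≤s z≤n

  placeOf⇒≤ : ∀ {m i c} → PlaceOf m i c → i ≤ m
  placeOf⇒≤ at-first           = s≤s z≤n
  placeOf⇒≤ (at-inner _ i<2+k) = <⇒≤ i<2+k
  placeOf⇒≤ at-last            = ≤-refl

  data Step : Set where
    stay step : Step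

  move : Step → ℕ → ℕ
  move stay i = i
  move step i = suc i

  stepLength : Step → ℕ
  stepLength stay = 0
  stepLength step = 1

  -- How many steps of kind s leave (resp. enter) a coordinate at place c of its line.
  departures : Step → Place → ℕ
  departures stay _    = 1
  departures step last = 0
  departures step _    = 1

  arrivals : Step → Place → ℕ
  arrivals stay _     = 1
  arrivals step first = 0
  arrivals step _     = 1

  count-departures : ∀ {m i c} → PlaceOf m i c → ∀ s →
                     count (_≡ᵇ i) (range1 (m ∸ stepLength s)) ≡ departures s c
  count-departures {m} pl s rewrite range1≡range (m ∸ stepLength s) = in-range pl s
    where
    in-range : ∀ {m i c} → PlaceOf m i c → ∀ s → count (_≡ᵇ i) (range 1 (m ∸ stepLength s)) ≡ departures s c
    in-range {m}     pl                 stay = count-range-inside 1 m (placeOf⇒1≤ pl) (s≤s (placeOf⇒≤ pl))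
    in-range {suc m} at-first           step = count-range-inside 1 m ≤-refl (s≤s (s≤s z≤n))
    in-range {suc m} (at-inner 1<i i<m) step = count-range-inside 1 m (<⇒≤ 1<i) i<m
    in-range {suc m} at-last            step = count-range-above 1 m ≤-refl

  count-arrivals : ∀ {m i c} → PlaceOf m i c → ∀ s →
                   count (λ x → move s x ≡ᵇ i) (range1 (m ∸ stepLength s)) ≡ arrivals s c
  count-arrivals pl stay = count-departures pl stay
  count-arrivals {suc m} {i} {c} pl step = begin
    count (λ x → suc x ≡ᵇ i) (range1 m)  ≡⟨ cong (count (λ x → suc x ≡ᵇ i)) (range1≡range m) ⟩
    count (λ x → suc x ≡ᵇ i) (range 1 m) ≡⟨ sym (count-map (_≡ᵇ i) suc (range 1 m)) ⟩
    count (_≡ᵇ i) (map suc (range 1 m))  ≡⟨ cong (count (_≡ᵇ i)) (map-suc-range 1 m) ⟩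
    count (_≡ᵇ i) (range 2 m)            ≡⟨ in-range pl ⟩
    arrivals step c                      ∎
    where
    open ≡-Reasoning
    in-range : ∀ {i c} → PlaceOf (suc m) i c → count (_≡ᵇ i) (range 2 m) ≡ arrivals step c
    in-range at-first           = count-range-below 2 m ≤-refl
    in-range (at-inner 1<i i<m) = count-range-inside 2 m 1<i (m<n⇒m<1+n i<m)
    in-range at-last            = count-range-inside 2 m (s≤s (s≤s z≤n)) ≤-refl

  data Direction : Set where
    horizontal vertical diagonal : Direction

  rowStep colStep : Direction → Step
  rowStep horizontal = stay
  rowStep vertical   = step
  rowStep diagonal   = step
  colStep horizontal = step
  colStep vertical   = stay
  colStep diagonal   = step

  block : ℕ → ℕ → Direction → List Edge
  block m n δ = concatMap (λ i → map (λ j → ((i , j) , (move (rowStep δ) i , move (colStep δ) j)))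
                                     (range1 (n ∸ stepLength (colStep δ))))
                          (range1 (m ∸ stepLength (rowStep δ)))

  triEdges≡blocks : ∀ m n → triEdges m n ≡ block m n horizontal ++ block m n vertical ++ block m n diagonal
  triEdges≡blocks m n = refl

  incident : Vertex → Edge → Bool
  incident v e = does (proj₁ e ≟V v) ∨ does (proj₂ e ≟V v)

  ≟V-does : ∀ x y i j → does ((x , y) ≟V (i , j)) ≡ (x ≡ᵇ i) ∧ (y ≡ᵇ j)
  ≟V-does x y i j with x ≟ i
  ... | yes refl = cong (_∧ (y ≡ᵇ j)) (sym (dec-true (x ≟ x) refl))
  ... | no  x≢i  = cong (_∧ (y ≡ᵇ j)) (sym (dec-false (x ≟ i) x≢i))

  ≡ᵇ-suc-disjoint : ∀ x i → (x ≡ᵇ i) ∧ (suc x ≡ᵇ i) ≡ false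
  ≡ᵇ-suc-disjoint zero    zero    = refl
  ≡ᵇ-suc-disjoint zero    (suc i) = refl
  ≡ᵇ-suc-disjoint (suc x) zero    = refl
  ≡ᵇ-suc-disjoint (suc x) (suc i) = ≡ᵇ-suc-disjoint x i

  endpoints-distinct : ∀ δ i j x y →
    ((x ≡ᵇ i) ∧ (y ≡ᵇ j)) ∧ ((move (rowStep δ) x ≡ᵇ i) ∧ (move (colStep δ) y ≡ᵇ j)) ≡ false
  endpoints-distinct horizontal i j x y =
    ∧-disjointʳ (x ≡ᵇ i) (y ≡ᵇ j) (x ≡ᵇ i) (suc y ≡ᵇ j) (≡ᵇ-suc-disjoint y j)
  endpoints-distinct vertical   i j x y =
    ∧-disjointˡ (x ≡ᵇ i) (y ≡ᵇ j) (suc x ≡ᵇ i) (y ≡ᵇ j) (≡ᵇ-suc-disjoint x i)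
  endpoints-distinct diagonal   i j x y =
    ∧-disjointˡ (x ≡ᵇ i) (y ≡ᵇ j) (suc x ≡ᵇ i) (suc y ≡ᵇ j) (≡ᵇ-suc-disjoint x i)

  degreeIn : Direction → Place → Place → ℕ
  degreeIn δ c d = departures (rowStep δ) c * departures (colStep δ) d
                 + arrivals (rowStep δ) c * arrivals (colStep δ) d

  count-block : ∀ {m n i j c d} → PlaceOf m i c → PlaceOf n j d → ∀ δ →
                count (incident (i , j)) (block m n δ) ≡ degreeIn δ c d
  count-block {m} {n} {i} {j} pi pj δ = begin
    count (incident (i , j)) (block m n δ)
      ≡⟨ count-grid (incident (i , j)) (λ x y → ((x , y) , (move r x , move s y)))
                    (_≡ᵇ i) (λ x → move r x ≡ᵇ i) (_≡ᵇ j) (λ y → move s y ≡ᵇ j)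
                    (λ x y → cong₂ _∨_ (≟V-does x y i j) (≟V-does (move r x) (move s y) i j))
                    (endpoints-distinct δ i j)
                    (range1 (m ∸ stepLength r)) (range1 (n ∸ stepLength s)) ⟩
    _ ≡⟨ cong₂ _+_ (cong₂ _*_ (count-departures pi r) (count-departures pj s))
                   (cong₂ _*_ (count-arrivals pi r) (count-arrivals pj s)) ⟩
    degreeIn δ _ _ ∎
    where
    open ≡-Reasoning
    r s : Step
    r = rowStep δ
    s = colStep δ

  data Degree : Set where
    deg2 deg3 deg4 deg6 : Degree

  degreeValue : Degree → ℕ
  degreeValue deg2 = 2
  degreeValue deg3 = 3
  degreeValue deg4 = 4
  degreeValue deg6 = 6

  degreeAt : Place → Place → Degree
  degreeAt first first = deg3
  degreeAt first inner = deg4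
  degreeAt first last  = deg2
  degreeAt inner first = deg4
  degreeAt inner inner = deg6
  degreeAt inner last  = deg4
  degreeAt last  first = deg2
  degreeAt last  inner = deg4
  degreeAt last  last  = deg3

  degreeIn-sum : ∀ c d → degreeIn horizontal c d + (degreeIn vertical c d + degreeIn diagonal c d)
                       ≡ degreeValue (degreeAt c d)
  degreeIn-sum first first = refl
  degreeIn-sum first inner = refl
  degreeIn-sum first last  = refl
  degreeIn-sum inner first = refl
  degreeIn-sum inner inner = refl
  degreeIn-sum inner last  = refl
  degreeIn-sum last  first = refl
  degreeIn-sum last  inner = refl
  degreeIn-sum last  last  = refl

  degree-placed : ∀ {m n i j c d} → PlaceOf m i c → PlaceOf n j d →
                  degree m n (i , j) ≡ degreeValue (degreeAt c d)
  degree-placed {m} {n} {i} {j} {c} {d} pi pj = begin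
    degree m n (i , j)
      ≡⟨ length-filter≡count (λ e → (proj₁ e ≟V (i , j)) ⊎-dec (proj₂ e ≟V (i , j))) (triEdges m n) ⟩
    count (incident (i , j)) (triEdges m n)
      ≡⟨ cong (count (incident (i , j))) (triEdges≡blocks m n) ⟩
    count (incident (i , j)) (block m n horizontal ++ block m n vertical ++ block m n diagonal)
      ≡⟨ trans (count-++ (incident (i , j)) (block m n horizontal) _)
               (cong (count (incident (i , j)) (block m n horizontal) +_)
                     (count-++ (incident (i , j)) (block m n vertical) _)) ⟩
    _ ≡⟨ cong₂ _+_ (count-block pi pj horizontal)
                   (cong₂ _+_ (count-block pi pj vertical) (count-block pi pj diagonal)) ⟩
    degreeIn horizontal c d + (degreeIn vertical c d + degreeIn diagonal c d)
      ≡⟨ degreeIn-sum c d ⟩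
    degreeValue (degreeAt c d) ∎
    where open ≡-Reasoning

open Degrees

-- Stated over arbitrary operations so that the same expressions can be read in a ring and, via
-- ring-solver syntax, normalised.
module Expressions {a} {S : Set a} (_⊕_ _⊗_ : S → S → S) (0s 1s : S) where

  numeral : ℕ → S
  numeral zero    = 0s
  numeral (suc k) = 1s ⊕ numeral k

  power : Degree → S → S → S
  power deg2 t₂ t₃ = t₂
  power deg3 t₂ t₃ = t₃
  power deg4 t₂ t₃ = t₂ ⊗ t₂
  power deg6 t₂ t₃ = t₂ ⊗ t₃

  -- Sum of f (place of i) (place of move s i) along a line of k + 3 coordinates, which has
  -- k + 1 inner coordinates and k inner-to-inner steps.
  lineSum : Step → S → (Place → Place → S) → S
  lineSum stay k f = f first first ⊕ (((1s ⊕ k) ⊗ f inner inner) ⊕ f last last)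
  lineSum step k f = f first inner ⊕ ((k ⊗ f inner inner) ⊕ f inner last)

  module _ (a₂ a₃ b₂ b₃ : S) where

    edgeWeight : Degree → Degree → S
    edgeWeight d e = (power d a₂ a₃ ⊗ power e b₂ b₃) ⊕ (power e a₂ a₃ ⊗ power d b₂ b₃)

    crossWeight : Degree → Degree → S
    crossWeight d e = (power d a₂ a₃ ⊗ power e b₂ b₃) ⊕ (power d b₂ b₃ ⊗ power e a₂ a₃)

    blockSum : S → S → Direction → S
    blockSum P Q δ = lineSum (rowStep δ) P λ c c′ → lineSum (colStep δ) Q λ d d′ →
                       edgeWeight (degreeAt c d) (degreeAt c′ d′)

    zagrebSum : S → S → S
    zagrebSum P Q = blockSum P Q horizontal ⊕ (blockSum P Q vertical ⊕ blockSum P Q diagonal)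

  zagrebShape : (C N A₁ A₂ A₃ A₄ A₅ A₆ : S) → S
  zagrebShape C N A₁ A₂ A₃ A₄ A₅ A₆ =
    (((((numeral 4 ⊗ A₁) ⊕ ((numeral 2 ⊗ C) ⊗ A₂)) ⊕ (numeral 2 ⊗ A₃)) ⊕ (N ⊗ A₄))
      ⊕ ((numeral 4 ⊗ N) ⊗ A₅)) ⊕ (numeral 4 ⊗ A₆)

  -- With P = m − 3 and Q = n − 3: 3PQ + P + Q = 3(mn + 7) − 8(m + n) and 1 + P + Q = m + n − 5.
  closedForm : (P Q a₂ a₃ b₂ b₃ : S) → S
  closedForm P Q a₂ a₃ b₂ b₃ = zagrebShape
    (((numeral 3 ⊗ (P ⊗ Q)) ⊕ P) ⊕ Q)
    (1s ⊕ (P ⊕ Q))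
    ((a₂ ⊗ (b₂ ⊗ b₂)) ⊕ ((a₂ ⊗ a₂) ⊗ b₂))
    ((a₂ ⊗ b₂) ⊗ (a₃ ⊗ b₃))
    (crossWeight a₂ a₃ b₂ b₃ deg3 deg6)
    (((a₂ ⊗ b₂) ⊗ numeral 2) ⊗ ((a₂ ⊗ b₂) ⊗ numeral 2))
    (crossWeight a₂ a₃ b₂ b₃ deg4 deg6)
    (crossWeight a₂ a₃ b₂ b₃ deg3 deg4)

module RingIdentities {c ℓ : Level} (R : CommutativeRing c ℓ) where
  open CommutativeRing R
  open import Algebra.Solver.Ring.NaturalCoefficients.Default commutativeSemiring
  private
    module E = Expressions _+_ _*_ 0# 1#
    module Syntax {n} = Expressions {S = Polynomial n} _:+_ _:*_ (con 0) (con 1)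

  zagrebSum≈closedForm : ∀ P Q a₂ a₃ b₂ b₃ → E.zagrebSum a₂ a₃ b₂ b₃ P Q ≈ E.closedForm P Q a₂ a₃ b₂ b₃
  zagrebSum≈closedForm = solve 6 (λ P Q a₂ a₃ b₂ b₃ →
    Syntax.zagrebSum a₂ a₃ b₂ b₃ P Q := Syntax.closedForm P Q a₂ a₃ b₂ b₃) refl

  2*x≈x+x : ∀ x → ι R 2 * x ≈ x + x
  2*x≈x+x = solve 1 (λ x → (con 1 :+ (con 1 :+ con 0)) :* x := x :+ x) refl

module Sums {c ℓ : Level} (R : CommutativeRing c ℓ) where
  open CommutativeRing R
  open import Data.Nat using (_<_; z≤n)
  import Data.Nat as ℕ
  import Data.Nat.Properties as ℕₚ
  open import Data.Nat.Properties using (≤-refl; ≤-trans; n≤1+n; m≤m+n; m<n⇒m<1+n; +-suc)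
  open import Data.List using (List; []; _∷_; map; concatMap; _++_)
  import Relation.Binary.PropositionalEquality as ≡
  open import Relation.Binary.Reasoning.Setoid setoid
  open Expressions _+_ _*_ 0# 1#

  ι-+ : ∀ x y → ι R (x ℕ.+ y) ≈ ι R x + ι R y
  ι-+ zero    y = sym (+-identityˡ (ι R y))
  ι-+ (suc x) y = trans (+-congˡ (ι-+ x y)) (sym (+-assoc 1# (ι R x) (ι R y)))

  ι-* : ∀ x y → ι R (x ℕ.* y) ≈ ι R x * ι R y
  ι-* zero    y = sym (zeroˡ (ι R y))
  ι-* (suc x) y = begin
    ι R (y ℕ.+ x ℕ.* y)        ≈⟨ ι-+ y (x ℕ.* y) ⟩
    ι R y + ι R (x ℕ.* y)      ≈⟨ +-cong (sym (*-identityˡ (ι R y))) (ι-* x y) ⟩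
    1# * ι R y + ι R x * ι R y ≈⟨ sym (distribʳ (ι R y) 1# (ι R x)) ⟩
    (1# + ι R x) * ι R y       ∎

  sumR-map-++ : ∀ {A : Set} (t : A → Carrier) xs ys →
                sumR R (map t (xs ++ ys)) ≈ sumR R (map t xs) + sumR R (map t ys)
  sumR-map-++ t []       ys = sym (+-identityˡ _)
  sumR-map-++ t (x ∷ xs) ys = trans (+-congˡ (sumR-map-++ t xs ys)) (sym (+-assoc (t x) _ _))

  sumR-concatMap : ∀ {A B : Set} (t : B → Carrier) (f : A → List B) xs →
                   sumR R (map t (concatMap f xs)) ≈ sumR R (map (λ x → sumR R (map t (f x))) xs)
  sumR-concatMap t f []       = refl
  sumR-concatMap t f (x ∷ xs) =
    trans (sumR-map-++ t (f x) (concatMap f xs)) (+-congˡ (sumR-concatMap t f xs))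

  sum-range : ∀ (f : ℕ → Carrier) {β γ} s k → (∀ {x} → s ≤ x → x < s ℕ.+ k → f x ≈ β) → f (s ℕ.+ k) ≈ γ →
              sumR R (map f (range s (suc k))) ≈ ι R k * β + γ
  sum-range f {β} {γ} s zero _ f-last = begin
    f s + 0#   ≈⟨ +-identityʳ (f s) ⟩
    f s        ≈⟨ ≡.subst (λ x → f x ≈ γ) (ℕₚ.+-identityʳ s) f-last ⟩
    γ          ≈⟨ sym (+-identityˡ γ) ⟩
    0# + γ     ≈⟨ +-congʳ (sym (zeroˡ β)) ⟩
    0# * β + γ ∎
  sum-range f {β} {γ} s (suc k) f-mid f-last = begin
    f s + sumR R (map f (range (suc s) (suc k)))
      ≈⟨ +-cong (f-mid ≤-refl (≡.subst (s <_) (≡.sym (+-suc s k)) (s≤s (m≤m+n s k))))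
                (sum-range f (suc s) k
                           (λ {x} s<x x<s+k → f-mid (≤-trans (n≤1+n s) s<x) (≡.subst (x <_) (≡.sym (+-suc s k)) x<s+k))
                           (≡.subst (λ x → f x ≈ γ) (+-suc s k) f-last)) ⟩
    β + (ι R k * β + γ)        ≈⟨ sym (+-assoc β _ γ) ⟩
    (β + ι R k * β) + γ        ≈⟨ +-congʳ (+-congʳ (sym (*-identityˡ β))) ⟩
    (1# * β + ι R k * β) + γ   ≈⟨ +-congʳ (sym (distribʳ β 1# (ι R k))) ⟩
    (1# + ι R k) * β + γ       ∎

  sum-line : ∀ p s (g : ℕ → Carrier) (f : Place → Place → Carrier) →
             (∀ {i c c′} → PlaceOf (3 ℕ.+ p) i c → PlaceOf (3 ℕ.+ p) (move s i) c′ → g i ≈ f c c′) →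
             sumR R (map g (range1 (3 ℕ.+ p ℕ.∸ stepLength s))) ≈ lineSum s (ι R p) f
  sum-line p stay g f g≈f = begin
    sumR R (map g (range1 (3 ℕ.+ p)))  ≡⟨ ≡.cong (λ xs → sumR R (map g xs)) (range1≡range (3 ℕ.+ p)) ⟩
    g 1 + sumR R (map g (range 2 (2 ℕ.+ p)))
      ≈⟨ +-cong (g≈f at-first at-first)
                (sum-range g 2 (suc p) (λ 1<x x<3+p → g≈f (at-inner 1<x x<3+p) (at-inner 1<x x<3+p))
                                       (g≈f at-last at-last)) ⟩
    lineSum stay (ι R p) f ∎
  sum-line p step g f g≈f = begin
    sumR R (map g (range1 (2 ℕ.+ p)))  ≡⟨ ≡.cong (λ xs → sumR R (map g xs)) (range1≡range (2 ℕ.+ p)) ⟩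
    g 1 + sumR R (map g (range 2 (suc p)))
      ≈⟨ +-cong (g≈f at-first (at-inner ≤-refl (s≤s (s≤s (s≤s z≤n)))))
                (sum-range g 2 p (λ 1<x x<2+p → g≈f (at-inner 1<x (m<n⇒m<1+n x<2+p))
                                                    (at-inner (m<n⇒m<1+n 1<x) (s≤s x<2+p)))
                                 (g≈f (at-inner (s≤s (s≤s z≤n)) ≤-refl) at-last)) ⟩
    lineSum step (ι R p) f ∎

module Zagreb {c ℓ : Level} (R : CommutativeRing c ℓ)
              (pow : ℕ → CommutativeRing.Carrier R → CommutativeRing.Carrier R) (isPow : IsPow R pow) where
  open CommutativeRing R
  open IsPow isPow
  import Data.Nat as ℕ
  open import Data.Nat.Tactic.RingSolver using (solve-∀)
  open import Data.Product using (_,_)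
  open import Data.List using (List; map; _++_)
  open import Data.List.Properties using (map-∘)
  import Relation.Binary.PropositionalEquality as ≡
  open ≡ using (_≡_)
  open import Relation.Binary.Reasoning.Setoid setoid
  open import Algebra.Properties.AbelianGroup +-abelianGroup using (xyx⁻¹≈y)
  open Expressions _+_ _*_ 0# 1#
  open Sums R
  open RingIdentities R using (2*x≈x+x)

  zagrebShape-cong : ∀ {C N A₁ A₂ A₃ A₄ A₅ A₆ C′ N′ A₁′ A₂′ A₃′ A₄′ A₅′ A₆′} →
                     C ≈ C′ → N ≈ N′ → A₁ ≈ A₁′ → A₂ ≈ A₂′ → A₃ ≈ A₃′ → A₄ ≈ A₄′ → A₅ ≈ A₅′ → A₆ ≈ A₆′ →
                     zagrebShape C N A₁ A₂ A₃ A₄ A₅ A₆ ≈ zagrebShape C′ N′ A₁′ A₂′ A₃′ A₄′ A₅′ A₆′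
  zagrebShape-cong C N A₁ A₂ A₃ A₄ A₅ A₆ =
    +-cong (+-cong (+-cong (+-cong (+-cong (*-congˡ A₁) (*-cong (*-congˡ C) A₂)) (*-congˡ A₃)) (*-cong N A₄))
                   (*-cong (*-congˡ N) A₅))
           (*-congˡ A₆)

  pow-degree : ∀ d x → pow (degreeValue d) x ≈ power d (pow 2 x) (pow 3 x)
  pow-degree deg2 x = refl
  pow-degree deg3 x = refl
  pow-degree deg4 x = pow-* 1 1 x
  pow-degree deg6 x = pow-* 1 2 x

  module _ (p q : ℕ) (a b : Carrier) where

    private
      m n : ℕ
      m = 3 ℕ.+ p
      n = 3 ℕ.+ q

      P Q a₂ a₃ b₂ b₃ : Carrier
      P  = ι R p
      Q  = ι R q
      a₂ = pow 2 a
      a₃ = pow 3 a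
      b₂ = pow 2 b
      b₃ = pow 3 b

    weight : Edge → Carrier
    weight (u , v) = pow (degree m n u) a * pow (degree m n v) b + pow (degree m n v) a * pow (degree m n u) b

    pow-placed : ∀ {i j c d} → PlaceOf m i c → PlaceOf n j d → ∀ x →
                 pow (degree m n (i , j)) x ≈ power (degreeAt c d) (pow 2 x) (pow 3 x)
    pow-placed {c = c} {d} pi pj x =
      trans (reflexive (≡.cong (λ k → pow k x) (degree-placed pi pj))) (pow-degree (degreeAt c d) x)

    weight-placed : ∀ {i j i′ j′ c d c′ d′} → PlaceOf m i c → PlaceOf n j d → PlaceOf m i′ c′ → PlaceOf n j′ d′ →
                    weight ((i , j) , (i′ , j′)) ≈ edgeWeight a₂ a₃ b₂ b₃ (degreeAt c d) (degreeAt c′ d′)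
    weight-placed pi pj pi′ pj′ = +-cong (*-cong (pow-placed pi pj a) (pow-placed pi′ pj′ b))
                                         (*-cong (pow-placed pi′ pj′ a) (pow-placed pi pj b))

    sum-block : ∀ δ → sumR R (map weight (block m n δ)) ≈ blockSum a₂ a₃ b₂ b₃ P Q δ
    sum-block δ = trans (sumR-concatMap weight row (range1 (m ℕ.∸ stepLength (rowStep δ))))
                        (sum-line p (rowStep δ) (λ i → sumR R (map weight (row i))) rowWeight row-sum)
      where
      row : ℕ → List Edge
      row i = map (λ j → ((i , j) , (move (rowStep δ) i , move (colStep δ) j)))
                  (range1 (n ℕ.∸ stepLength (colStep δ)))

      rowWeight : Place → Place → Carrier
      rowWeight c c′ = lineSum (colStep δ) Q λ d d′ → edgeWeight a₂ a₃ b₂ b₃ (degreeAt c d) (degreeAt c′ d′)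

      row-sum : ∀ {i c c′} → PlaceOf m i c → PlaceOf m (move (rowStep δ) i) c′ →
                sumR R (map weight (row i)) ≈ rowWeight c c′
      row-sum {i} {c} {c′} pi pi′ =
        trans (reflexive (≡.cong (sumR R) (≡.sym (map-∘ (range1 (n ℕ.∸ stepLength (colStep δ)))))))
              (sum-line q (colStep δ) (λ j → weight ((i , j) , (move (rowStep δ) i , move (colStep δ) j)))
                        (λ d d′ → edgeWeight a₂ a₃ b₂ b₃ (degreeAt c d) (degreeAt c′ d′))
                        (λ pj pj′ → weight-placed pi pj pi′ pj′))

    zagreb≈zagrebSum : zagreb R pow m n a b ≈ zagrebSum a₂ a₃ b₂ b₃ P Q
    zagreb≈zagrebSum = begin
      zagreb R pow m n a b
        ≡⟨ ≡.cong (λ es → sumR R (map weight es)) (triEdges≡blocks m n) ⟩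
      sumR R (map weight (block m n horizontal ++ block m n vertical ++ block m n diagonal))
        ≈⟨ sumR-map-++ weight (block m n horizontal) (block m n vertical ++ block m n diagonal) ⟩
      sumR R (map weight (block m n horizontal)) + sumR R (map weight (block m n vertical ++ block m n diagonal))
        ≈⟨ +-cong (sum-block horizontal)
                  (trans (sumR-map-++ weight (block m n vertical) (block m n diagonal))
                         (+-cong (sum-block vertical) (sum-block diagonal))) ⟩
      zagrebSum a₂ a₃ b₂ b₃ P Q ∎

    interior-coefficient : ι R (3 ℕ.* (m ℕ.* n ℕ.+ 7)) - ι R (8 ℕ.* (m ℕ.+ n)) ≈ ((numeral 3 * (P * Q)) + P) + Q
    interior-coefficient = begin
      ι R (3 ℕ.* (m ℕ.* n ℕ.+ 7)) - ι R B ≡⟨ ≡.cong (λ k → ι R k - ι R B) (split p q) ⟩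
      ι R (B ℕ.+ C) - ι R B               ≈⟨ +-congʳ (ι-+ B C) ⟩
      (ι R B + ι R C) - ι R B             ≈⟨ xyx⁻¹≈y (ι R B) (ι R C) ⟩
      ι R (3 ℕ.* (p ℕ.* q) ℕ.+ p ℕ.+ q)   ≈⟨ ι-+ (3 ℕ.* (p ℕ.* q) ℕ.+ p) q ⟩
      ι R (3 ℕ.* (p ℕ.* q) ℕ.+ p) + Q     ≈⟨ +-congʳ (ι-+ (3 ℕ.* (p ℕ.* q)) p) ⟩
      (ι R (3 ℕ.* (p ℕ.* q)) + P) + Q     ≈⟨ +-congʳ (+-congʳ (trans (ι-* 3 (p ℕ.* q)) (*-congˡ (ι-* p q)))) ⟩
      ((numeral 3 * (P * Q)) + P) + Q     ∎
      where
      B C : ℕ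
      B = 8 ℕ.* (m ℕ.+ n)
      C = 3 ℕ.* (p ℕ.* q) ℕ.+ p ℕ.+ q
      split : ∀ p q → 3 ℕ.* ((3 ℕ.+ p) ℕ.* (3 ℕ.+ q) ℕ.+ 7)
                      ≡ 8 ℕ.* ((3 ℕ.+ p) ℕ.+ (3 ℕ.+ q)) ℕ.+ (3 ℕ.* (p ℕ.* q) ℕ.+ p ℕ.+ q)
      split = solve-∀

    boundary-coefficient : ι R (m ℕ.+ n) - ι R 5 ≈ 1# + (P + Q)
    boundary-coefficient = begin
      ι R (m ℕ.+ n) - ι R 5                 ≡⟨ ≡.cong (λ k → ι R k - ι R 5) (split p q) ⟩
      ι R (5 ℕ.+ suc (p ℕ.+ q)) - ι R 5     ≈⟨ +-congʳ (ι-+ 5 (suc (p ℕ.+ q))) ⟩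
      (ι R 5 + ι R (suc (p ℕ.+ q))) - ι R 5 ≈⟨ xyx⁻¹≈y (ι R 5) (ι R (suc (p ℕ.+ q))) ⟩
      1# + ι R (p ℕ.+ q)                    ≈⟨ +-congˡ (ι-+ p q) ⟩
      1# + (P + Q)                          ∎
      where
      split : ∀ p q → (3 ℕ.+ p) ℕ.+ (3 ℕ.+ q) ≡ 5 ℕ.+ suc (p ℕ.+ q)
      split = solve-∀

    pow-a+2b : pow 2 (a + (b + b)) + pow 2 ((a + a) + b) ≈ (a₂ * (b₂ * b₂)) + ((a₂ * a₂) * b₂)
    pow-a+2b = +-cong (trans (pow-+ 1 a (b + b)) (*-congˡ (pow-+ 1 b b)))
                      (trans (pow-+ 1 (a + a) b) (*-congʳ (pow-+ 1 a a)))

    pow-6-a+b : pow 6 (a + b) ≈ (a₂ * b₂) * (a₃ * b₃)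
    pow-6-a+b = trans (pow-* 1 2 (a + b)) (*-cong (pow-+ 1 a b) (pow-+ 2 a b))

    pow-2-2[a+b+1] : pow 2 (ι R 2 * ((a + b) + 1#)) ≈ ((a₂ * b₂) * ι R 2) * ((a₂ * b₂) * ι R 2)
    pow-2-2[a+b+1] =
      trans (pow-cong 2 (2*x≈x+x ((a + b) + 1#))) (trans (pow-+ 1 _ _) (*-cong pow-2-a+b+1 pow-2-a+b+1))
      where
      pow-2-a+b+1 : pow 2 ((a + b) + 1#) ≈ (a₂ * b₂) * ι R 2
      pow-2-a+b+1 = trans (pow-+ 1 (a + b) 1#) (*-cong (pow-+ 1 a b) (pow-1 1))

    pow-cross : ∀ d e → pow (degreeValue d) a * pow (degreeValue e) b + pow (degreeValue d) b * pow (degreeValue e) a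
                        ≈ crossWeight a₂ a₃ b₂ b₃ d e
    pow-cross d e = +-cong (*-cong (pow-degree d a) (pow-degree e b)) (*-cong (pow-degree d b) (pow-degree e a))

    closedForm≈zagrebShape : closedForm P Q a₂ a₃ b₂ b₃ ≈ zagrebShape
      (ι R (3 ℕ.* (m ℕ.* n ℕ.+ 7)) - ι R (8 ℕ.* (m ℕ.+ n))) (ι R (m ℕ.+ n) - ι R 5)
      (pow 2 (a + (b + b)) + pow 2 ((a + a) + b)) (pow 6 (a + b)) (pow 3 a * pow 6 b + pow 3 b * pow 6 a)
      (pow 2 (ι R 2 * ((a + b) + 1#))) (pow 4 a * pow 6 b + pow 4 b * pow 6 a) (pow 3 a * pow 4 b + pow 3 b * pow 4 a)
    closedForm≈zagrebShape = sym (zagrebShape-cong interior-coefficient boundary-coefficient pow-a+2b pow-6-a+b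
      (pow-cross deg3 deg6) pow-2-2[a+b+1] (pow-cross deg4 deg6) (pow-cross deg3 deg4))

theorem4 : {c ℓ : Level} (R : CommutativeRing c ℓ) →
    let open CommutativeRing R in
    (pow : ℕ → Carrier → Carrier) → IsPow R pow →
    (m n : ℕ) → 3 ≤ m → 3 ≤ n → (a b : Carrier) →
    zagreb R pow m n a b ≈
        ι R 4 * (pow 2 (a + (b + b)) + pow 2 ((a + a) + b))
      + ι R 2 * (ι R (3 Data.Nat.* (m Data.Nat.* n Data.Nat.+ 7)) - ι R (8 Data.Nat.* (m Data.Nat.+ n))) * pow 6 (a + b)
      + ι R 2 * (pow 3 a * pow 6 b + pow 3 b * pow 6 a)
      + (ι R (m Data.Nat.+ n) - ι R 5) * pow 2 (ι R 2 * ((a + b) + 1#))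
      + ι R 4 * (ι R (m Data.Nat.+ n) - ι R 5) * (pow 4 a * pow 6 b + pow 4 b * pow 6 a)
      + ι R 4 * (pow 3 a * pow 4 b + pow 3 b * pow 4 a)
theorem4 R pow isPow _ _ (s≤s (s≤s (s≤s {n = p} _))) (s≤s (s≤s (s≤s {n = q} _))) a b =
  trans (zagreb≈zagrebSum p q a b)
        (trans (zagrebSum≈closedForm (ι R p) (ι R q) (pow 2 a) (pow 3 a) (pow 2 b) (pow 3 b))
               (closedForm≈zagrebShape p q a b))
  where
  open CommutativeRing R using (trans)
  open Zagreb R pow isPow
  open RingIdentities R using (zagrebSum≈closedForm)
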